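{- Let $m,n$ be positive integers. If $mn-m-n>5$, then $\widehat{K}_{m,n}\notin\mathfrak{N}$, where $K_{m,n}$ is the complete bipartite graph with parts of sizes $m$ and $n$.
   Context: All graphs are finite, without loops or multiple edges. An interval $t$-coloring of a graph $H$ is a proper edge-coloring of $H$ with colors $1,\ldots,t$ such that every color is used and for every vertex $v$ the set of colors of edges incident to $v$ is an interval of integers. $\mathfrak{N}$ denotes the set of graphs having an interval $t$-coloring for some positive integer $t$. For a graph $G$, $\widehat{G}$ is the graph obtained by subdividing every edge $v_iv_j$ of $G$ with a new vertex $w_{ij}$ (replacing $v_iv_j$ by $v_iw_{ij},v_jw_{ij}$) and then adding a new vertex $u$ adjacent to all the subdivision vertices $w_{ij}$. -}

module Defs where

open import Data.Nat using (ℕ; _≤_; _<_; _+_; _*_; _∸_)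
open import Data.Fin using (Fin)
import Data.Fin as F
open import Data.Sum using (_⊎_; inj₁; inj₂)
open import Data.Unit using (⊤; tt)
open import Data.Empty using (⊥)
open import Data.Product using (Σ; _×_; _,_; ∃-syntax)
open import Relation.Binary.PropositionalEquality using (_≡_)
open import Relation.Nullary using (¬_)

record Graph : Set₁ where
  field
    V     : Set
    Adj   : V → V → Set
    sym   : ∀ {x y} → Adj x y → Adj y x
    irr   : ∀ {x} → ¬ Adj x x
open Graph public

-- An interval t-coloring of G.  Colours are assigned to ordered adjacent
-- pairs, symmetric, so each (undirected) edge gets one colour.
record IntervalColoring (G : Graph) (t : ℕ) : Set where
  field
    col       : (x y : V G) → Adj G x y → ℕ
    col-sym   : ∀ x y (e : Adj G x y) → col y x (sym G e) ≡ col x y e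
    col-range : ∀ x y (e : Adj G x y) → 1 ≤ col x y e × col x y e ≤ t
    proper    : ∀ x y z (e : Adj G x y) (f : Adj G x z) →
                col x y e ≡ col x z f → y ≡ z
    surj      : ∀ k → 1 ≤ k → k ≤ t → ∃[ x ] ∃[ y ] Σ (Adj G x y) λ e → col x y e ≡ k
    interval  : ∀ x y z (e : Adj G x y) (f : Adj G x z) k →
                col x y e ≤ k → k ≤ col x z f →
                ∃[ w ] Σ (Adj G x w) λ g → col x w g ≡ k

InN : Graph → Set
InN G = ∃[ t ] (1 ≤ t × IntervalColoring G t)

KAdj : (m n : ℕ) → Fin m ⊎ Fin n → Fin m ⊎ Fin n → Set
KAdj m n (inj₁ _) (inj₂ _) = ⊤
KAdj m n (inj₂ _) (inj₁ _) = ⊤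
KAdj m n (inj₁ _) (inj₁ _) = ⊥
KAdj m n (inj₂ _) (inj₂ _) = ⊥

K : ℕ → ℕ → Graph
K m n = record { V = Fin m ⊎ Fin n ; Adj = KAdj m n ; sym = s ; irr = i }
  where
  s : ∀ {x y} → KAdj m n x y → KAdj m n y x
  s {inj₁ _} {inj₂ _} _ = tt
  s {inj₂ _} {inj₁ _} _ = tt
  i : ∀ {x} → ¬ KAdj m n x x
  i {inj₁ _} ()
  i {inj₂ _} ()

-- The graph Ĝ, for a graph G whose vertex set carries a strict total
-- order _≺_ (used only to pick one representative (i,j), i ≺ j, per edge).
-- Vertices: original vertices v_i, subdivision vertices w_ij (one per edge),
-- and the extra vertex u.
module Hat (G : Graph) (_≺_ : V G → V G → Set) where
  Edge : Set
  Edge = Σ (V G) λ i → Σ (V G) λ j → (i ≺ j) × Adj G i j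

  HV : Set
  HV = V G ⊎ (Edge ⊎ ⊤)

  HAdj : HV → HV → Set
  HAdj (inj₁ v) (inj₂ (inj₁ (i , j , _))) = (v ≡ i) ⊎ (v ≡ j)
  HAdj (inj₂ (inj₁ (i , j , _))) (inj₁ v) = (v ≡ i) ⊎ (v ≡ j)
  HAdj (inj₂ (inj₁ _)) (inj₂ (inj₂ _)) = ⊤
  HAdj (inj₂ (inj₂ _)) (inj₂ (inj₁ _)) = ⊤
  HAdj (inj₁ _) (inj₁ _) = ⊥
  HAdj (inj₁ _) (inj₂ (inj₂ _)) = ⊥
  HAdj (inj₂ (inj₂ _)) (inj₁ _) = ⊥
  HAdj (inj₂ (inj₁ _)) (inj₂ (inj₁ _)) = ⊥
  HAdj (inj₂ (inj₂ _)) (inj₂ (inj₂ _)) = ⊥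

  hsym : ∀ {x y} → HAdj x y → HAdj y x
  hsym {inj₁ v} {inj₂ (inj₁ _)} p = p
  hsym {inj₂ (inj₁ _)} {inj₁ v} p = p
  hsym {inj₂ (inj₁ _)} {inj₂ (inj₂ _)} _ = tt
  hsym {inj₂ (inj₂ _)} {inj₂ (inj₁ _)} _ = tt

  hirr : ∀ {x} → ¬ HAdj x x
  hirr {inj₁ _} ()
  hirr {inj₂ (inj₁ _)} ()
  hirr {inj₂ (inj₂ _)} ()

  Ĝ : Graph
  Ĝ = record { V = HV ; Adj = HAdj ; sym = hsym ; irr = hirr }

_≺K_ : ∀ {m n} → Fin m ⊎ Fin n → Fin m ⊎ Fin n → Set
inj₁ a ≺K inj₁ b = a F.< b
inj₁ _ ≺K inj₂ _ = ⊤
inj₂ _ ≺K inj₁ _ = ⊥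
inj₂ a ≺K inj₂ b = a F.< b

KHat : ℕ → ℕ → Graph
KHat m n = Hat.Ĝ (K m n) (_≺K_ {m} {n})

module Submission where

-- Suppose K̂_{m,n} has an interval colouring.  Two facts about interval
-- colourings are used:
--   * at a vertex of degree d, the colours form an interval of d distinct
--     integers, so any two of them differ by at most d - 1  (spanAt);
--   * the m·n colours at the apex u are distinct naturals, so two of them
--     differ by at least m·n - 1  (spread).
-- Write w_ab for the vertex subdividing the edge v_a v'_b of K_{m,n} and let
-- u w₀₀ carry the smallest and u w₁₁ the largest colour at u, where
-- w_ij = w_{a_i b_j}.  The walk through the edges
--   u w₁₁ → w₁₁ v'_b₁ → v'_b₁ w₀₁ → w₀₁ v_a₀ → v_a₀ w₀₀ → w₀₀ u
-- passes alternately through vertices of degree 3, m, 3, n, 3, so by spanAt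
-- consecutive colours differ by at most 2, m-1, 2, n-1, 2 (pathBound).  Hence
-- m·n - 1 ≤ m + n + 4, contradicting m·n - m - n > 5.
-- The file first proves the general facts about finite sets of naturals and
-- about interval colourings of arbitrary graphs, then the walk estimate in
-- K̂_{m,n}, and finally the corollary.

open import Defs
open import Data.Nat using (ℕ; zero; suc; _≤_; _<_; _+_; _*_; _∸_; s≤s; s≤s⁻¹; z≤n)
open import Data.Nat.Properties
open import Data.Nat.Tactic.RingSolver using (solve-∀)
open import Data.Fin as F using (Fin; toℕ; fromℕ<; remQuot; combine)
import Data.Fin.Properties as FP
open import Data.Sum using (_⊎_; inj₁; inj₂)
open import Data.Unit using (tt)
open import Data.Empty using (⊥)
open import Data.Product using (Σ; _×_; _,_; proj₁; proj₂; ∃-syntax; uncurry)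
open import Function using (_∘_)
open import Relation.Nullary using (¬_)
open import Relation.Binary.PropositionalEquality
  using (_≡_; refl; cong; trans; subst; subst₂; module ≡-Reasoning)
  renaming (sym to ≡-sym)

extremum : ∀ {A : Set} {N} (R : A → A → Set) → (∀ {a} → R a a) →
           (∀ {a b c} → R a b → R b c → R a c) → (∀ a b → R a b ⊎ R b a) →
           (g : Fin (suc N) → A) → Σ (Fin (suc N)) λ i → ∀ k → R (g i) (g k)
extremum {N = zero} R refl-R trans-R total-R g = F.zero , λ { F.zero → refl-R }
extremum {N = suc N} R refl-R trans-R total-R g
  with extremum R refl-R trans-R total-R (g ∘ F.suc)
... | i , best with total-R (g F.zero) (g (F.suc i))
...   | inj₁ r = F.zero , λ { F.zero → refl-R ; (F.suc k) → trans-R r (best k) }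
...   | inj₂ r = F.suc i , λ { F.zero → r ; (F.suc k) → best k }

injectiveInto : ∀ {N} (h : Fin N → ℕ) (L U : ℕ) →
                (∀ i j → h i ≡ h j → i ≡ j) → (∀ k → L ≤ h k) → (∀ k → h k ≤ U) →
                N ≤ suc (U ∸ L)
injectiveInto h L U inj L≤h h≤U = FP.injective⇒≤ {f = offset} offset-injective
  where
  offset : _ → Fin (suc (U ∸ L))
  offset k = fromℕ< (s≤s (∸-monoˡ-≤ L (h≤U k)))
  offset-injective : ∀ {i j} → offset i ≡ offset j → i ≡ j
  offset-injective {i} {j} eq = inj i j (begin
    h i           ≡⟨ ≡-sym (m∸n+n≡m (L≤h i)) ⟩
    h i ∸ L + L   ≡⟨ cong (_+ L) (begin
                       h i ∸ L           ≡⟨ ≡-sym (FP.toℕ-fromℕ< _) ⟩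
                       toℕ (offset i)    ≡⟨ cong toℕ eq ⟩
                       toℕ (offset j)    ≡⟨ FP.toℕ-fromℕ< _ ⟩
                       h j ∸ L           ∎) ⟩
    h j ∸ L + L   ≡⟨ m∸n+n≡m (L≤h j) ⟩
    h j           ∎)
    where open ≡-Reasoning

spread : ∀ N (g : Fin (suc N) → ℕ) → (∀ i j → g i ≡ g j → i ≡ j) →
         ∃[ i ] ∃[ j ] (g i + N ≤ g j)
spread N g inj = i , j , (begin
  g i + N             ≤⟨ +-monoʳ-≤ (g i) N≤gap ⟩
  g i + (g j ∸ g i)   ≡⟨ m+[n∸m]≡n (least j) ⟩
  g j                 ∎)
  where
  open ≤-Reasoning
  min = extremum (λ a b → a ≤ b) ≤-refl ≤-trans ≤-total g
  max = extremum (λ a b → b ≤ a) ≤-refl (λ p q → ≤-trans q p) (λ a b → ≤-total b a) g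
  i = proj₁ min
  j = proj₁ max
  least = proj₂ min
  greatest = proj₂ max
  N≤gap : N ≤ g j ∸ g i
  N≤gap = s≤s⁻¹ (injectiveInto g (g i) (g j) inj least greatest)

≤+-trans : ∀ {x y z} a b → x ≤ y + a → y ≤ z + b → x ≤ z + (b + a)
≤+-trans {x} {y} {z} a b x≤y+a y≤z+b = begin
  x             ≤⟨ x≤y+a ⟩
  y + a         ≤⟨ +-monoˡ-≤ a y≤z+b ⟩
  z + b + a     ≡⟨ +-assoc z b a ⟩
  z + (b + a)   ∎
  where open ≤-Reasoning

module IntervalFacts (G : Graph) {t : ℕ} (C : IntervalColoring G t) where
  open IntervalColoring C

  Incident : V G → Set
  Incident x = Σ (V G) (Adj G x)

  colour : ∀ x → Incident x → ℕ
  colour x (y , e) = col x y e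

  CoveredBy : ∀ x {d} → (Fin (suc d) → Incident x) → Set
  CoveredBy x nb = ∀ e → ∃[ k ] colour x e ≡ colour x (nb k)

  -- At a vertex whose colours are covered by d + 1 edges, any two colours
  -- differ by at most d: otherwise the interval property yields d + 2
  -- distinct colours c, …, c + d + 1 at x, i.e. an injection Fin (d + 2) →
  -- Fin (d + 1) into the indices of the cover.
  spanAt : ∀ x d (nb : Fin (suc d) → Incident x) → CoveredBy x nb →
           ∀ e e' → colour x e' ≤ colour x e + d
  spanAt x d nb covered (y , g) (z , h) = ≮⇒≥ too-far
    where
    c = col x y g
    too-far : ¬ (c + d < col x z h)
    too-far c+d<top = <-irrefl refl (FP.injective⇒≤ {f = index} index-injective)
      where
      top : c + suc d ≤ col x z h
      top = subst (_≤ col x z h) (≡-sym (+-suc c d)) c+d<top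
      occurs : ∀ (k : Fin (suc (suc d))) → ∃[ w ] Σ (Adj G x w) λ f → col x w f ≡ c + toℕ k
      occurs k = interval x y z g h (c + toℕ k) (m≤m+n c _)
                   (≤-trans (+-monoʳ-≤ c (FP.toℕ≤pred[n] k)) top)
      index : Fin (suc (suc d)) → Fin (suc d)
      index k with occurs k
      ... | w , f , _ = proj₁ (covered (w , f))
      index-colour : ∀ k → colour x (nb (index k)) ≡ c + toℕ k
      index-colour k with occurs k
      ... | w , f , eq = trans (≡-sym (proj₂ (covered (w , f)))) eq
      index-injective : ∀ {k k'} → index k ≡ index k' → k ≡ k'
      index-injective {k} {k'} eq = FP.toℕ-injective (+-cancelˡ-≡ c _ _
        (trans (≡-sym (index-colour k)) (trans (cong (colour x ∘ nb) eq) (index-colour k'))))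

module Walk (m' n' : ℕ) where
  m n : ℕ
  m = suc m'
  n = suc n'
  open Hat (K m n) (_≺K_ {m} {n})

  vL : Fin m → HV
  vL a = inj₁ (inj₁ a)
  vR : Fin n → HV
  vR b = inj₁ (inj₂ b)
  w : Fin m → Fin n → HV
  w a b = inj₂ (inj₁ (inj₁ a , inj₂ b , tt , tt))
  u : HV
  u = inj₂ (inj₂ tt)

  w-injective : ∀ {a b a' b'} → w a b ≡ w a' b' → (a , b) ≡ (a' , b')
  w-injective refl = refl

  module _ {t : ℕ} (C : IntervalColoring (KHat m n) t) where
    open IntervalColoring C
    open IntervalFacts (KHat m n) C

    nbW : ∀ a b → Fin 3 → Incident (w a b)
    nbW a b F.zero = vL a , inj₁ refl
    nbW a b (F.suc F.zero) = vR b , inj₂ refl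
    nbW a b (F.suc (F.suc F.zero)) = u , tt

    coveredW : ∀ a b → CoveredBy (w a b) (nbW a b)
    coveredW a b (inj₁ .(inj₁ a) , inj₁ refl) = F.zero , refl
    coveredW a b (inj₁ .(inj₂ b) , inj₂ refl) = F.suc F.zero , refl
    coveredW a b (inj₂ (inj₂ tt) , tt) = F.suc (F.suc F.zero) , refl

    nbL : ∀ a → Fin n → Incident (vL a)
    nbL a b = w a b , inj₁ refl

    coveredL : ∀ a → CoveredBy (vL a) (nbL a)
    coveredL a (inj₂ (inj₁ (inj₁ .a , inj₂ b , tt , tt)) , inj₁ refl) = b , refl
    coveredL a (inj₂ (inj₁ (inj₁ .a , inj₁ _ , _ , ())) , inj₁ refl)
    coveredL a (inj₂ (inj₁ (inj₂ _ , inj₁ .a , () , _)) , inj₂ refl)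
    coveredL a (inj₂ (inj₁ (inj₁ _ , inj₁ .a , _ , ())) , inj₂ refl)

    nbR : ∀ b → Fin m → Incident (vR b)
    nbR b a = w a b , inj₂ refl

    coveredR : ∀ b → CoveredBy (vR b) (nbR b)
    coveredR b (inj₂ (inj₁ (inj₁ a , inj₂ .b , tt , tt)) , inj₂ refl) = a , refl
    coveredR b (inj₂ (inj₁ (inj₂ .b , inj₂ _ , _ , ())) , inj₁ refl)
    coveredR b (inj₂ (inj₁ (inj₂ .b , inj₁ _ , () , _)) , inj₁ refl)
    coveredR b (inj₂ (inj₁ (inj₂ _ , inj₂ .b , _ , ())) , inj₂ refl)

    cL cR cU : Fin m → Fin n → ℕ
    cL a b = colour (w a b) (nbW a b F.zero)
    cR a b = colour (w a b) (nbW a b (F.suc F.zero))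
    cU a b = colour (w a b) (nbW a b (F.suc (F.suc F.zero)))

    atW : ∀ a b i j → colour (w a b) (nbW a b j) ≤ colour (w a b) (nbW a b i) + 2
    atW a b i j = spanAt (w a b) 2 (nbW a b) (coveredW a b) (nbW a b i) (nbW a b j)

    atL : ∀ a b b' → cL a b' ≤ cL a b + n'
    atL a b b' = subst₂ _≤_ (≡-sym (col-sym (vL a) (w a b') (inj₁ refl)))
                            (cong (_+ n') (≡-sym (col-sym (vL a) (w a b) (inj₁ refl))))
                   (spanAt (vL a) n' (nbL a) (coveredL a) (nbL a b) (nbL a b'))

    atR : ∀ a a' b → cR a' b ≤ cR a b + m'
    atR a a' b = subst₂ _≤_ (≡-sym (col-sym (vR b) (w a' b) (inj₂ refl)))
                            (cong (_+ m') (≡-sym (col-sym (vR b) (w a b) (inj₂ refl))))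
                   (spanAt (vR b) m' (nbR b) (coveredR b) (nbR b a) (nbR b a'))

    -- Along the walk u w₁₁ v'_b₁ w₀₁ v_a₀ w₀₀ u consecutive edge colours
    -- differ by at most 2, m - 1, 2, n - 1, 2 (spanAt at w₁₁, v'_b₁, w₀₁, v_a₀, w₀₀).
    pathBound : ∀ a₀ b₀ a₁ b₁ → cU a₁ b₁ ≤ cU a₀ b₀ + (m' + n' + 6)
    pathBound a₀ b₀ a₁ b₁ = subst (λ s → cU a₁ b₁ ≤ cU a₀ b₀ + s) (slack m' n')
      (≤+-trans 2 (((2 + n') + 2) + m') (atW a₁ b₁ (F.suc F.zero) (F.suc (F.suc F.zero)))
      (≤+-trans m' ((2 + n') + 2) (atR a₀ a₁ b₁)
      (≤+-trans 2 (2 + n') (atW a₀ b₁ F.zero (F.suc F.zero))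
      (≤+-trans n' 2 (atL a₀ b₀ b₁)
                     (atW a₀ b₀ (F.suc (F.suc F.zero)) F.zero)))))
      where
      slack : ∀ m' n' → (((2 + n') + 2) + m') + 2 ≡ m' + n' + 6
      slack = solve-∀

    position : Fin (m * n) → Fin m × Fin n
    position = remQuot {m} n

    colourAtU : Fin (m * n) → ℕ
    colourAtU k = uncurry cU (position k)

    colourAtU-injective : ∀ i j → colourAtU i ≡ colourAtU j → i ≡ j
    colourAtU-injective i j eq = begin
      i                             ≡⟨ ≡-sym (FP.combine-remQuot {m} n i) ⟩
      uncurry combine (position i)  ≡⟨ cong (uncurry combine) (w-injective (proper u _ _ tt tt same)) ⟩
      uncurry combine (position j)  ≡⟨ FP.combine-remQuot {m} n j ⟩
      j                             ∎
      where
      open ≡-Reasoning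
      wAt : Fin (m * n) → HV
      wAt k = uncurry w (position k)
      fromU : ∀ k → col u (wAt k) tt ≡ colourAtU k
      fromU k = col-sym (wAt k) u tt
      same : col u (wAt i) tt ≡ col u (wAt j) tt
      same = trans (fromU i) (trans eq (≡-sym (fromU j)))

    noColouring : 5 + (m + n) < m * n → ⊥
    noColouring lt with spread (n' + m' * n) colourAtU colourAtU-injective
    ... | i , j , gap = <-irrefl refl (begin-strict
      suc (m' + n' + 6)       ≡⟨ total m' n' ⟩
      5 + (m + n)             <⟨ lt ⟩
      m * n                   ≡⟨⟩
      suc (n' + m' * n)       ≤⟨ s≤s (+-cancelˡ-≤ (colourAtU i) _ _ (≤-trans gap (pathBound _ _ _ _))) ⟩
      suc (m' + n' + 6)       ∎)
      where
      open ≤-Reasoning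
      total : ∀ m' n' → suc (m' + n' + 6) ≡ 5 + (suc m' + suc n')
      total = solve-∀

corollary4 : ∀ (m n : ℕ) → 1 ≤ m → 1 ≤ n → 5 + (m + n) < m * n → ¬ InN (KHat m n)
corollary4 (suc m') (suc n') (s≤s z≤n) (s≤s z≤n) lt (t , _ , C) = Walk.noColouring m' n' C lt
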